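{- Let $A,B$ be types and $F:(A\to B^\nu)\to(A\to B^\nu)$ be finitary. Then $\mathsf{Y}(F)$ is the least prefixed point of $F$: for every $f:A\to B^\nu$ with $F\,f\sqsubseteq f$, we have $\mathsf{Y}(F)\sqsubseteq f$.
   Context: Work in an intensional constructive dependent type theory with inductive and coinductive types. For a type $B$, $B^\nu$ is the coinductive type with constructors $\mathsf{return}:B\to B^\nu$ and $\mathsf{step}:B^\nu\to B^\nu$; $\mathsf{step}^\infty=\mathsf{step}\,\mathsf{step}^\infty$ (corecursively). Convergence $x\downarrow b$ is inductive: $\mathsf{return}\,b\downarrow b$; $x\downarrow b\Rightarrow\mathsf{step}\,x\downarrow b$. The convergence order $x\sqsubseteq y$ is coinductive with rules: if $x\downarrow b$ and $y\downarrow b$ then $x\sqsubseteq y$; if $x\sqsubseteq y$ then $\mathsf{step}\,x\sqsubseteq\mathsf{step}\,y$; if $x\sqsubseteq y$ then $\mathsf{step}\,x\sqsubseteq y$; for functions $f_1\sqsubseteq f_2$ iff $\forall a:A.\,f_1\,a\sqsubseteq f_2\,a$. $F$ is finitary if for every $f:A\to B^\nu$, $a:A$, $b:B$ with $F\,f\,a\downarrow b$, there exist finitely many $a_1,\dots,a_n:A$ and $b_1,\dots,b_n:B$ with $f\,a_i\downarrow b_i$ for all $i$ such that for every $g:A\to B^\nu$, if $g\,a_i\downarrow b_i$ for all $i$ then $F\,g\,a\downarrow b$. $\mathsf{fstconv}:B^\nu\to B^\nu\to B^\nu$ is defined corecursively by $\mathsf{fstconv}\,(\mathsf{return}\,b)\,y=\mathsf{return}\,b$;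 $\mathsf{fstconv}\,(\mathsf{step}\,x)\,(\mathsf{return}\,b)=\mathsf{return}\,b$; $\mathsf{fstconv}\,(\mathsf{step}\,x)\,(\mathsf{step}\,y)=\mathsf{step}(\mathsf{fstconv}\,x\,y)$. $\mathsf{psa}:(\mathbb{N}\to B^\nu)\to\mathbb{N}\to B^\nu\to B^\nu$ is defined corecursively by $\mathsf{psa}\,f\,n\,(\mathsf{return}\,b)=\mathsf{return}\,b$, $\mathsf{psa}\,f\,n\,(\mathsf{step}\,x)=\mathsf{step}(\mathsf{psa}\,f\,(n+1)\,(\mathsf{fstconv}\,x\,(f\,n)))$, and $\mathsf{parallel\_search}\,f=\mathsf{psa}\,f\,0\,\mathsf{step}^\infty$. Let $k_0=\lambda a.\,\mathsf{step}^\infty$ and $k_{n+1}=F\,k_n$. Then $\mathsf{Y}(F)=\lambda a:A.\,\mathsf{parallel\_search}(\lambda n.\,k_n\,a)$. -}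

module Defs where

open import Level using (Level; _⊔_) renaming (suc to lsuc)
open import Data.Nat using (ℕ; zero; suc)
open import Data.Fin using (Fin)
open import Data.Maybe using (Maybe; just; nothing)
open import Data.Sum using (_⊎_; inj₁; inj₂)
open import Data.Product using (Σ; _×_; _,_; proj₁)
open import Relation.Binary.PropositionalEquality using (_≡_; refl; trans)

private variable ℓ : Level

-- B^ν as stable sequences: d n = just b means "after n steps it returns b",
-- d n = nothing means "the n-th layer is a step".  Stability makes this
-- (pointwise) isomorphic to the final coalgebra of X ↦ B ⊎ X.

Stable : {B : Set ℓ} → (ℕ → Maybe B) → Set ℓ
Stable {B = B} d = (n : ℕ) (b : B) → d n ≡ just b → d (suc n) ≡ just b

record Delay (B : Set ℓ) : Set ℓ where
  constructor mkDelay
  field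
    run    : ℕ → Maybe B
    stable : Stable run
open Delay public

head : {B : Set ℓ} → Delay B → Maybe B
head x = run x 0

tail : {B : Set ℓ} → Delay B → Delay B
tail x = mkDelay (λ n → run x (suc n)) (λ n → stable x (suc n))

return : {B : Set ℓ} → B → Delay B
return b = mkDelay (λ _ → just b) (λ _ _ e → e)

step : {B : Set ℓ} → Delay B → Delay B
step {B = B} x = mkDelay r s
  where
  r : ℕ → Maybe B
  r zero    = nothing
  r (suc n) = run x n
  s : Stable r
  s zero    b ()
  s (suc n) b e = stable x n b e

unfoldD : {B S : Set ℓ} → (S → B ⊎ S) → S → Delay B
unfoldD {B = B} {S} c s₀ = mkDelay (r s₀) (s s₀)
  where
  r : S → ℕ → Maybe B
  r s n with c s
  r s n       | inj₁ b  = just b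
  r s zero    | inj₂ s' = nothing
  r s (suc n) | inj₂ s' = r s' n
  s : (t : S) → Stable (r t)
  s t n b e with c t
  s t n       b e  | inj₁ b' = e
  s t zero    b () | inj₂ t'
  s t (suc n) b e  | inj₂ t' = s t' n b e

step∞ : {B : Set ℓ} → Delay B
step∞ = mkDelay (λ _ → nothing) (λ _ _ ())

data _↓_ {B : Set ℓ} (x : Delay B) (b : B) : Set ℓ where
  ↓-return : head x ≡ just b → x ↓ b
  ↓-step   : head x ≡ nothing → tail x ↓ b → x ↓ b

-- Convergence order (coinductive): greatest fixed point of the rules,
-- i.e. x ⊑ y iff (x,y) lies in some relation closed backwards under the rules.

⊑Rules : {B : Set ℓ} → (Delay B → Delay B → Set ℓ) → Delay B → Delay B → Set ℓ
⊑Rules {B = B} R x y =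
  (Σ B λ b → x ↓ b × y ↓ b)
  ⊎ (head x ≡ nothing × head y ≡ nothing × R (tail x) (tail y))
  ⊎ (head x ≡ nothing × R (tail x) y)

_⊑_ : {B : Set ℓ} → Delay B → Delay B → Set (lsuc ℓ)
_⊑_ {ℓ} {B} x y =
  Σ (Delay B → Delay B → Set ℓ) λ R →
    ((u v : Delay B) → R u v → ⊑Rules R u v) × R x y

_⊑ᶠ_ : {A B : Set ℓ} → (A → Delay B) → (A → Delay B) → Set (lsuc ℓ)
f₁ ⊑ᶠ f₂ = ∀ a → f₁ a ⊑ f₂ a

Finitary : {A B : Set ℓ} → ((A → Delay B) → (A → Delay B)) → Set ℓ
Finitary {A = A} {B} F =
  (f : A → Delay B) (a : A) (b : B) → F f a ↓ b →
  Σ ℕ λ n → Σ (Fin n → A) λ as → Σ (Fin n → B) λ bs →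
    ((i : Fin n) → f (as i) ↓ bs i) ×
    ((g : A → Delay B) → ((i : Fin n) → g (as i) ↓ bs i) → F g a ↓ b)

-- fstconv, defined corecursively by
--   fstconv (return b) y = return b
--   fstconv (step x) (return b) = return b
--   fstconv (step x) (step y) = step (fstconv x y)

fstconvC : {B : Set ℓ} → Delay B × Delay B → B ⊎ (Delay B × Delay B)
fstconvC (x , y) with head x | head y
... | just b  | _       = inj₁ b
... | nothing | just b  = inj₁ b
... | nothing | nothing = inj₂ (tail x , tail y)

fstconv : {B : Set ℓ} → Delay B → Delay B → Delay B
fstconv x y = unfoldD fstconvC (x , y)

-- psa, defined corecursively by
--   psa f n (return b) = return b
--   psa f n (step x)   = step (psa f (n+1) (fstconv x (f n)))

psaC : {B : Set ℓ} → (ℕ → Delay B) → ℕ × Delay B → B ⊎ (ℕ × Delay B)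
psaC f (n , x) with head x
... | just b  = inj₁ b
... | nothing = inj₂ (suc n , fstconv (tail x) (f n))

psa : {B : Set ℓ} → (ℕ → Delay B) → ℕ → Delay B → Delay B
psa f n x = unfoldD (psaC f) (n , x)

parallel-search : {B : Set ℓ} → (ℕ → Delay B) → Delay B
parallel-search f = psa f 0 step∞

iter : {A B : Set ℓ} → ((A → Delay B) → (A → Delay B)) → ℕ → (A → Delay B)
iter F zero    = λ _ → step∞
iter F (suc n) = F (iter F n)

Y : {A B : Set ℓ} → ((A → Delay B) → (A → Delay B)) → (A → Delay B)
Y F a = parallel-search (λ n → iter F n a)

-- Convergence of x determines x ⊑ y: x ⊑ y holds exactly when every value x converges to is also
-- a value of y.  A value of Y(F) a = parallel-search (λ n → kₙ a) is found by fstconv inside psa,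
-- which only ever copies values of its arguments, so it is a value of some iterate kₙ a.  By
-- induction on n these are values of f a: k₀ diverges, and a value of F kₙ a depends on finitely
-- many values of kₙ, which f shares by induction, so it is a value of F f a and hence of f a.
module Submission where

open import Defs
open import Level using (Level)
open import Data.Nat using (ℕ; zero; suc)
open import Data.Maybe using (just; nothing)
open import Data.Maybe.Properties using (just-injective)
open import Data.Sum as Sum using (_⊎_; inj₁; inj₂; [_,_]′)
open import Data.Product using (∃-syntax; _,_)
open import Data.Empty using (⊥-elim)
open import Function using (_∘_; id)
open import Relation.Nullary using (¬_)
open import Relation.Binary.PropositionalEquality

private variable
  ℓ ℓ′ : Level

module _ {B : Set ℓ} where

  ↓-functional : {x : Delay B} {b b′ : B} → x ↓ b → x ↓ b′ → b ≡ b′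
  ↓-functional (↓-return e) (↓-return e′) = just-injective (trans (sym e) e′)
  ↓-functional (↓-return e) (↓-step e′ _) with () ← trans (sym e′) e
  ↓-functional (↓-step e _) (↓-return e′) with () ← trans (sym e) e′
  ↓-functional (↓-step _ d) (↓-step _ d′) = ↓-functional d d′

  step∞-diverges : {b : B} → ¬ step∞ ↓ b
  step∞-diverges (↓-step _ d) = step∞-diverges d

  ⊑⇒↓ : {x y : Delay B} → x ⊑ y → {b : B} → x ↓ b → y ↓ b
  ⊑⇒↓ {x} {y} (R , closed , xRy) {b} = go x y xRy
    where
    go : ∀ u v → R u v → u ↓ b → v ↓ b
    go u v uRv d with closed u v uRv | d
    ... | inj₁ (_ , du , dv)              | _            = subst (v ↓_) (↓-functional du d) dv
    ... | inj₂ (inj₁ (hu , _))            | ↓-return e   with () ← trans (sym hu) e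
    ... | inj₂ (inj₁ (_ , hv , tuRtv))    | ↓-step _ d′  = ↓-step hv (go (tail u) (tail v) tuRtv d′)
    ... | inj₂ (inj₂ (hu , _))            | ↓-return e   with () ← trans (sym hu) e
    ... | inj₂ (inj₂ (_ , tuRv))          | ↓-step _ d′  = go (tail u) v tuRv d′

  ↓⇒⊑ : {x y : Delay B} → (∀ {b} → x ↓ b → y ↓ b) → x ⊑ y
  ↓⇒⊑ x↓⇒y↓ = Preserves↓ , closed , x↓⇒y↓
    where
    Preserves↓ : Delay B → Delay B → Set ℓ
    Preserves↓ u v = ∀ {b} → u ↓ b → v ↓ b
    closed : ∀ u v → Preserves↓ u v → ⊑Rules Preserves↓ u v
    closed u v u↓⇒v↓ with head u in hu
    ... | just b  = inj₁ (b , ↓-return hu , u↓⇒v↓ (↓-return hu))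
    ... | nothing = inj₂ (inj₂ (refl , λ d → u↓⇒v↓ (↓-step hu d)))

module _ {B S : Set ℓ} (c : S → B ⊎ S) where

  unfoldD-↓-elim : {b : B} (P : S → Set ℓ′) →
    (∀ {s} → c s ≡ inj₁ b → P s) →
    (∀ {s s′} → c s ≡ inj₂ s′ → P s′ → P s) →
    ∀ s → unfoldD c s ↓ b → P s
  unfoldD-↓-elim {b = b} P returns steps s = go s (λ _ → refl)
    where
    -- tail (unfoldD c s) is only pointwise equal to unfoldD c s′, so the induction runs over a
    -- derivation for any x with the same run.
    go : ∀ {x} s → (∀ n → run x n ≡ run (unfoldD c s) n) → x ↓ b → P s
    go s x≗ d with c s in cs | d
    ... | inj₁ _  | ↓-return e  = returns (trans cs (cong inj₁ (just-injective (trans (sym (x≗ 0)) e))))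
    ... | inj₁ _  | ↓-step e _  with () ← trans (sym e) (x≗ 0)
    ... | inj₂ _  | ↓-return e  with () ← trans (sym (x≗ 0)) e
    ... | inj₂ s′ | ↓-step _ d′ = steps cs (go s′ (λ n → x≗ (suc n)) d′)

module _ {B : Set ℓ} where

  fstconv-sound : {x y : Delay B} {b : B} → fstconv x y ↓ b → x ↓ b ⊎ y ↓ b
  fstconv-sound {x} {y} {b} = unfoldD-↓-elim fstconvC (λ (x , y) → x ↓ b ⊎ y ↓ b) returns steps (x , y)
    where
    returns : ∀ {x y} → fstconvC (x , y) ≡ inj₁ b → x ↓ b ⊎ y ↓ b
    returns {x} {y} eq with head x in hx | head y in hy | eq
    ... | just _  | _      | refl = inj₁ (↓-return hx)
    ... | nothing | just _ | refl = inj₂ (↓-return hy)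

    steps : ∀ {x y x′ y′} → fstconvC (x , y) ≡ inj₂ (x′ , y′) → x′ ↓ b ⊎ y′ ↓ b → x ↓ b ⊎ y ↓ b
    steps {x} {y} eq with head x in hx | head y in hy | eq
    ... | nothing | nothing | refl = Sum.map (↓-step hx) (↓-step hy)

  psa-sound : {g : ℕ → Delay B} {k : ℕ} {x : Delay B} {b : B} →
    psa g k x ↓ b → x ↓ b ⊎ ∃[ m ] g m ↓ b
  psa-sound {g} {k} {x} {b} = unfoldD-↓-elim (psaC g) (λ (_ , x) → x ↓ b ⊎ ∃[ m ] g m ↓ b) returns steps (k , x)
    where
    returns : ∀ {k x} → psaC g (k , x) ≡ inj₁ b → x ↓ b ⊎ ∃[ m ] g m ↓ b
    returns {x = x} eq with head x in hx | eq
    ... | just _ | refl = inj₁ (↓-return hx)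

    steps : ∀ {k x k′ x′} → psaC g (k , x) ≡ inj₂ (k′ , x′) →
      x′ ↓ b ⊎ ∃[ m ] g m ↓ b → x ↓ b ⊎ ∃[ m ] g m ↓ b
    steps {k} {x} eq with head x in hx | eq
    ... | nothing | refl = [ Sum.map (↓-step hx) (k ,_) ∘ fstconv-sound , inj₂ ]′

  parallel-search-sound : {g : ℕ → Delay B} {b : B} → parallel-search g ↓ b → ∃[ m ] g m ↓ b
  parallel-search-sound d = [ ⊥-elim ∘ step∞-diverges , id ]′ (psa-sound d)

module _ {A B : Set ℓ} {F : (A → Delay B) → (A → Delay B)} where

  iter-below-prefixed : Finitary F → {f : A → Delay B} → F f ⊑ᶠ f →
    ∀ n a {b} → iter F n a ↓ b → f a ↓ b
  iter-below-prefixed fin pre zero    a d = ⊥-elim (step∞-diverges d)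
  iter-below-prefixed fin pre (suc n) a {b} d
    with _ , as , bs , iter-as↓bs , F-respects ← fin (iter F n) a b d =
    ⊑⇒↓ (pre a) (F-respects _ (λ i → iter-below-prefixed fin pre n (as i) (iter-as↓bs i)))

theorem6p20 : {ℓ : Level} {A B : Set ℓ} (F : (A → Delay B) → (A → Delay B)) →
    Finitary F → (f : A → Delay B) → F f ⊑ᶠ f → Y F ⊑ᶠ f
theorem6p20 F fin f pre a = ↓⇒⊑ λ d →
  let n , iterₙ↓ = parallel-search-sound d in iter-below-prefixed fin pre n a iterₙ↓
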